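{- Let $(b,w)\in\mathbb{N}^2$ (nonnegative integers). There exists a partition $\lambda$ with $(b(\lambda),w(\lambda))=(b,w)$ if and only if $$(b-w)^2\le b.$$ Furthermore, the same statement holds if $\lambda$ is required to be a partition into distinct parts.
   Context: A partition is a finite nonincreasing sequence $\lambda=(\lambda_1\ge\lambda_2\ge\dots\ge\lambda_r)$ of positive integers. The empty sequence is allowed and is the unique partition of $0$. Its Ferrers graph consists of the unit squares in positions $(r',c)$ (row $r'\ge 0$, column $c\ge 0$) with $0\le c<\lambda_{r'+1}$. In the chess colouring, the square in row $r'$ and column $c$ is black if $r'+c$ is even and white if $r'+c$ is odd. Thus the corner square in row $0$, column $0$ is black. Here $b(\lambda)$ denotes the number of black squares and $w(\lambda)$ the number of white squares. Equivalently, $$b(\lambda)=\sum_{j}\Big\lceil \tfrac{\lambda_{2j+1}}{2}\Big\rceil+\sum_j\Big\lfloor\tfrac{\lambda_{2j}}{2}\Big\rfloor,\qquad w(\lambda)=\sum_{j}\Big\lfloor \tfrac{\lambda_{2j+1}}{2}\Big\rfloor+\sum_j\Big\lceil\tfrac{\lambda_{2j}}{2}\Big\rceil,$$ with the convention $\lambda_i=0$ for $i<1$ or $i>r$. A partition into distinct parts is one with $\lambda_1>\lambda_2>\dots>\lambda_r$. -}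

module Defs where

open import Data.Nat using (ℕ; zero; suc; _+_; _≥_; _>_; _/_)
open import Data.Nat.Properties using ()
open import Data.List using (List; []; _∷_)
open import Data.List.Relation.Unary.All using (All)
open import Data.List.Relation.Unary.Linked using (Linked)
open import Data.Product using (_×_; _,_)

IsPartition : List ℕ → Set
IsPartition λs = Linked _≥_ λs × All (λ x → x > 0) λs

IsDistinctPartition : List ℕ → Set
IsDistinctPartition λs = Linked _>_ λs × All (λ x → x > 0) λs

⌈_/2⌉ : ℕ → ℕ
⌈ n /2⌉ = (n + 1) / 2

⌊_/2⌋ : ℕ → ℕ
⌊ n /2⌋ = n / 2

-- Chess colouring of the Ferrers graph: row r' (0-based) of length l
-- has squares (r', c), 0 ≤ c < l; black iff r' + c even.
-- Rows at even index (λ₁, λ₃, ...) contribute ⌈l/2⌉ black, ⌊l/2⌋ white;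
-- rows at odd index contribute ⌊l/2⌋ black, ⌈l/2⌉ white.
-- *Even: counts for a list whose first row has even index; *Odd: odd index.
mutual
  blackEven : List ℕ → ℕ
  blackEven []       = 0
  blackEven (l ∷ ls) = ⌈ l /2⌉ + blackOdd ls

  blackOdd : List ℕ → ℕ
  blackOdd []       = 0
  blackOdd (l ∷ ls) = ⌊ l /2⌋ + blackEven ls

mutual
  whiteEven : List ℕ → ℕ
  whiteEven []       = 0
  whiteEven (l ∷ ls) = ⌊ l /2⌋ + whiteOdd ls

  whiteOdd : List ℕ → ℕ
  whiteOdd []       = 0
  whiteOdd (l ∷ ls) = ⌈ l /2⌉ + whiteEven ls

b : List ℕ → ℕ
b = blackEven

w : List ℕ → ℕ
w = whiteEven

-- Stripping dominoes (two adjacent squares, one of each colour) from a partition leaves its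
-- 2-core, a staircase δₖ = (k, k-1, …, 1); hence (b, w) = (t + b δₖ, t + w δₖ) for some t.
-- For δ₂ₘ the colour difference is -m and b = m², for δ₂ₘ₊₁ it is m + 1 and b = (m + 1)², so
-- (b - w)² = b δₖ ≤ b. Conversely each such pair is realised by δₖ with t dominoes laid along
-- its first row, a partition into distinct parts. The core is computed row by row: prepending
-- a row of length l ≥ k to a partition with core δₖ yields core δₖ₊₁ or δₖ₋₁, according to
-- the parity of l - k, so the core index never exceeds the first part.

module Submission where

open import Defs
open import Data.Nat using (ℕ)
open import Data.Integer using (ℤ; +_; _-_; _*_; _≤_)
open import Data.List using (List)
open import Data.Product using (Σ; _×_)
open import Relation.Binary.PropositionalEquality using (_≡_)
open import Function.Bundles using (_⇔_)

import Data.Nat as ℕ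
open import Data.Nat using (zero; suc; pred; _+_; _<_; _≥_; z≤n; s≤s)
open import Data.Nat.Properties
open import Data.Nat.DivMod using (m/n≡1+[m∸n]/n)
open import Data.Nat.Tactic.RingSolver using (solve-∀)
open import Algebra.Properties.CommutativeSemigroup +-commutativeSemigroup using (x∙yz≈y∙xz)
import Data.Integer as ℤ
open import Data.Integer using (+≤+)
open import Data.Integer.Properties using (pos-+; pos-*; drop‿+≤+)
import Data.Integer.Tactic.RingSolver as ℤ-Solver
open import Data.List using ([]; _∷_)
open import Data.List.Relation.Unary.All using ([]; _∷_)
open import Data.List.Relation.Unary.Linked as Linked using (Linked; []; [-]; _∷_)
open import Data.Product using (_,_; proj₁; proj₂; map₂; Σ-syntax)
open import Data.Sum using (inj₁; inj₂)
open import Function.Base using (_∘_)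
open import Function.Bundles using (mk⇔; Equivalence)
open import Relation.Binary.PropositionalEquality
  using (refl; sym; trans; cong; cong₂; subst; subst₂; module ≡-Reasoning)

⌊2+n/2⌋≡1+⌊n/2⌋ : ∀ n → ⌊ 2 + n /2⌋ ≡ suc ⌊ n /2⌋
⌊2+n/2⌋≡1+⌊n/2⌋ n = m/n≡1+[m∸n]/n {2 + n} (s≤s (s≤s z≤n))

⌈2+n/2⌉≡1+⌈n/2⌉ : ∀ n → ⌈ 2 + n /2⌉ ≡ suc ⌈ n /2⌉
⌈2+n/2⌉≡1+⌈n/2⌉ n = ⌊2+n/2⌋≡1+⌊n/2⌋ (n + 1)

⌈n/2⌉+⌊n/2⌋≡n : ∀ n → ⌈ n /2⌉ + ⌊ n /2⌋ ≡ n
⌈n/2⌉+⌊n/2⌋≡n zero = refl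
⌈n/2⌉+⌊n/2⌋≡n (suc zero) = refl
⌈n/2⌉+⌊n/2⌋≡n (suc (suc n)) = begin
  ⌈ 2 + n /2⌉ + ⌊ 2 + n /2⌋      ≡⟨ cong₂ _+_ (⌈2+n/2⌉≡1+⌈n/2⌉ n) (⌊2+n/2⌋≡1+⌊n/2⌋ n) ⟩
  suc ⌈ n /2⌉ + suc ⌊ n /2⌋      ≡⟨ cong suc (+-suc _ _) ⟩
  suc (suc (⌈ n /2⌉ + ⌊ n /2⌋))  ≡⟨ cong (suc ∘ suc) (⌈n/2⌉+⌊n/2⌋≡n n) ⟩
  suc (suc n)                    ∎
  where open ≡-Reasoning

⌊n+[m+m]/2⌋≡m+⌊n/2⌋ : ∀ n m → ⌊ n + (m + m) /2⌋ ≡ m + ⌊ n /2⌋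
⌊n+[m+m]/2⌋≡m+⌊n/2⌋ n zero = cong ⌊_/2⌋ (+-identityʳ n)
⌊n+[m+m]/2⌋≡m+⌊n/2⌋ n (suc m) = begin
  ⌊ n + (suc m + suc m) /2⌋  ≡⟨ cong ⌊_/2⌋ (regroup n m) ⟩
  ⌊ 2 + (n + (m + m)) /2⌋    ≡⟨ ⌊2+n/2⌋≡1+⌊n/2⌋ (n + (m + m)) ⟩
  suc ⌊ n + (m + m) /2⌋      ≡⟨ cong suc (⌊n+[m+m]/2⌋≡m+⌊n/2⌋ n m) ⟩
  suc m + ⌊ n /2⌋            ∎
  where
  open ≡-Reasoning
  regroup : ∀ n m → n + (suc m + suc m) ≡ 2 + (n + (m + m))
  regroup = solve-∀

⌈n+[m+m]/2⌉≡m+⌈n/2⌉ : ∀ n m → ⌈ n + (m + m) /2⌉ ≡ m + ⌈ n /2⌉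
⌈n+[m+m]/2⌉≡m+⌈n/2⌉ n m = begin
  ⌈ n + (m + m) /2⌉      ≡⟨ cong ⌊_/2⌋ (+-comm (n + (m + m)) 1) ⟩
  ⌊ suc n + (m + m) /2⌋  ≡⟨ ⌊n+[m+m]/2⌋≡m+⌊n/2⌋ (suc n) m ⟩
  m + ⌊ suc n /2⌋        ≡⟨ cong (λ x → m + ⌊ x /2⌋) (+-comm 1 n) ⟩
  m + ⌈ n /2⌉            ∎
  where open ≡-Reasoning

data Parity : ℕ → Set where
  even : ∀ m → Parity (m + m)
  odd  : ∀ m → Parity (suc (m + m))

parity : ∀ n → Parity n
parity zero = even 0
parity (suc n) with parity n
... | even m = odd m
... | odd m rewrite sym (+-suc m m) = even (suc m)

blackOdd≡w : ∀ ls → blackOdd ls ≡ w ls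
whiteOdd≡b : ∀ ls → whiteOdd ls ≡ b ls
blackOdd≡w [] = refl
blackOdd≡w (l ∷ ls) = cong (_+_ ⌊ l /2⌋) (sym (whiteOdd≡b ls))
whiteOdd≡b [] = refl
whiteOdd≡b (l ∷ ls) = cong (_+_ ⌈ l /2⌉) (sym (blackOdd≡w ls))

b-∷ : ∀ l ls → b (l ∷ ls) ≡ ⌈ l /2⌉ + w ls
b-∷ l ls = cong (_+_ ⌈ l /2⌉) (blackOdd≡w ls)

w-∷ : ∀ l ls → w (l ∷ ls) ≡ ⌊ l /2⌋ + b ls
w-∷ l ls = cong (_+_ ⌊ l /2⌋) (whiteOdd≡b ls)

b-widen : ∀ l s ls → b (l + (s + s) ∷ ls) ≡ s + b (l ∷ ls)
b-widen l s ls = trans (cong (_+ blackOdd ls) (⌈n+[m+m]/2⌉≡m+⌈n/2⌉ l s)) (+-assoc s _ _)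

w-widen : ∀ l s ls → w (l + (s + s) ∷ ls) ≡ s + w (l ∷ ls)
w-widen l s ls = trans (cong (_+ whiteOdd ls) (⌊n+[m+m]/2⌋≡m+⌊n/2⌋ l s)) (+-assoc s _ _)

staircase : ℕ → List ℕ
staircase zero = []
staircase (suc n) = suc n ∷ staircase n

staircase-∷ : ∀ {l} n → n < l → IsDistinctPartition (l ∷ staircase n)
staircase-∷ zero 0<l = [-] , 0<l ∷ []
staircase-∷ (suc n) n<l with staircase-∷ n (n<1+n n)
... | decreasing , positive = n<l ∷ decreasing , ≤-trans (s≤s z≤n) n<l ∷ positive

m+1+[m*m+m]≡[1+m]*[1+m] : ∀ m → m + 1 + (m ℕ.* m + m) ≡ suc m ℕ.* suc m
m+1+[m*m+m]≡[1+m]*[1+m] = solve-∀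

staircase-even : ∀ m → b (staircase (m + m)) ≡ m ℕ.* m
                     × w (staircase (m + m)) ≡ m ℕ.* m + m
staircase-odd : ∀ m → b (staircase (suc (m + m))) ≡ suc m ℕ.* suc m
                    × w (staircase (suc (m + m))) ≡ m ℕ.* m + m
staircase-even zero = refl , refl
staircase-even (suc m) rewrite +-suc m m =
  (begin
    b (staircase (2 + (m + m)))                      ≡⟨ b-∷ (2 + (m + m)) δ ⟩
    ⌈ 2 + (m + m) /2⌉ + w δ                          ≡⟨ cong₂ _+_ (⌈n+[m+m]/2⌉≡m+⌈n/2⌉ 2 m)
                                                                 (proj₂ (staircase-odd m)) ⟩
    m + 1 + (m ℕ.* m + m)                            ≡⟨ m+1+[m*m+m]≡[1+m]*[1+m] m ⟩
    suc m ℕ.* suc m                                  ∎) ,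
  (begin
    w (staircase (2 + (m + m)))                      ≡⟨ w-∷ (2 + (m + m)) δ ⟩
    ⌊ 2 + (m + m) /2⌋ + b δ                          ≡⟨ cong₂ _+_ (⌊n+[m+m]/2⌋≡m+⌊n/2⌋ 2 m)
                                                                 (proj₁ (staircase-odd m)) ⟩
    m + 1 + suc m ℕ.* suc m                          ≡⟨ +-comm (m + 1) _ ⟩
    suc m ℕ.* suc m + (m + 1)                        ≡⟨ cong (_+_ (suc m ℕ.* suc m)) (+-comm m 1) ⟩
    suc m ℕ.* suc m + suc m                          ∎)
  where
  open ≡-Reasoning
  δ : List ℕ
  δ = staircase (1 + (m + m))
staircase-odd m =
  (begin
    b (staircase (1 + (m + m)))                      ≡⟨ b-∷ (1 + (m + m)) δ ⟩
    ⌈ 1 + (m + m) /2⌉ + w δ                          ≡⟨ cong₂ _+_ (⌈n+[m+m]/2⌉≡m+⌈n/2⌉ 1 m)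
                                                                 (proj₂ (staircase-even m)) ⟩
    m + 1 + (m ℕ.* m + m)                            ≡⟨ m+1+[m*m+m]≡[1+m]*[1+m] m ⟩
    suc m ℕ.* suc m                                  ∎) ,
  (begin
    w (staircase (1 + (m + m)))                      ≡⟨ w-∷ (1 + (m + m)) δ ⟩
    ⌊ 1 + (m + m) /2⌋ + b δ                          ≡⟨ cong₂ _+_ (⌊n+[m+m]/2⌋≡m+⌊n/2⌋ 1 m)
                                                                 (proj₁ (staircase-even m)) ⟩
    m + 0 + m ℕ.* m                                  ≡⟨ cong (_+ m ℕ.* m) (+-identityʳ m) ⟩
    m + m ℕ.* m                                      ≡⟨ +-comm m _ ⟩
    m ℕ.* m + m                                      ∎)
  where
  open ≡-Reasoning
  δ : List ℕ
  δ = staircase (m + m)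

data DominoesOver (k : ℕ) : ℕ → ℕ → Set where
  dominoes : ∀ t → DominoesOver k (t + b (staircase k)) (t + w (staircase k))

DominoesOver-add : ∀ s {k B W} → DominoesOver k B W → DominoesOver k (s + B) (s + W)
DominoesOver-add s {k} (dominoes t) =
  subst₂ (DominoesOver k) (+-assoc s t _) (+-assoc s t _) (dominoes (s + t))

DominoesOver-widen : ∀ n s {k B W} → DominoesOver k (⌈ n /2⌉ + W) (⌊ n /2⌋ + B) →
                     DominoesOver k (⌈ n + (s + s) /2⌉ + W) (⌊ n + (s + s) /2⌋ + B)
DominoesOver-widen n s {k} {B} {W} d =
  subst₂ (DominoesOver k) (sym black) (sym white) (DominoesOver-add s d)
  where
  black : ⌈ n + (s + s) /2⌉ + W ≡ s + (⌈ n /2⌉ + W)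
  black = trans (cong (_+ W) (⌈n+[m+m]/2⌉≡m+⌈n/2⌉ n s)) (+-assoc s _ W)
  white : ⌊ n + (s + s) /2⌋ + B ≡ s + (⌊ n /2⌋ + B)
  white = trans (cong (_+ B) (⌊n+[m+m]/2⌋≡m+⌊n/2⌋ n s)) (+-assoc s _ B)

DominoesOver-prepend-suc : ∀ {k B W} → DominoesOver k B W →
                           DominoesOver (suc k) (⌈ suc k /2⌉ + W) (⌊ suc k /2⌋ + B)
DominoesOver-prepend-suc {k} (dominoes t) =
  subst₂ (DominoesOver (suc k))
    (shift ⌈ suc k /2⌉ (b-∷ (suc k) (staircase k)))
    (shift ⌊ suc k /2⌋ (w-∷ (suc k) (staircase k)))
    (dominoes t)
  where
  shift : ∀ h {x y} → y ≡ h + x → t + y ≡ h + (t + x)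
  shift h {x} eq = trans (cong (_+_ t) eq) (x∙yz≈y∙xz t h x)

-- The new row and the first row of δₖ form k vertical dominoes over δₖ₋₁.
DominoesOver-prepend-self : ∀ {k B W} → DominoesOver k B W →
                            DominoesOver (pred k) (⌈ k /2⌉ + W) (⌊ k /2⌋ + B)
DominoesOver-prepend-self {zero} (dominoes t) = dominoes t
DominoesOver-prepend-self {suc j} (dominoes t) =
  subst₂ (DominoesOver j)
    (absorb (w-∷ (suc j) (staircase j)) (⌈n/2⌉+⌊n/2⌋≡n (suc j)))
    (absorb (b-∷ (suc j) (staircase j)) (trans (+-comm ⌊ suc j /2⌋ _) (⌈n/2⌉+⌊n/2⌋≡n (suc j))))
    (dominoes (t + suc j))
  where
  rearrange : ∀ x t y z → t + (x + y) + z ≡ x + (t + (y + z))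
  rearrange = solve-∀
  absorb : ∀ {x y z v} → z ≡ y + v → x + y ≡ suc j → t + suc j + v ≡ x + (t + z)
  absorb {x} {y} {v = v} refl x+y≡1+j =
    trans (cong (λ n → t + n + v) (sym x+y≡1+j)) (rearrange x t y v)

DominoesOver-prepend : ∀ {k B W} l → k ℕ.≤ l → DominoesOver k B W →
                       Σ[ k′ ∈ ℕ ] k′ ℕ.≤ l × DominoesOver k′ (⌈ l /2⌉ + W) (⌊ l /2⌋ + B)
DominoesOver-prepend {k} l k≤l d with m≤n⇒∃[o]m+o≡n k≤l
... | o , refl with parity o
... | even s =
  pred k , ≤-trans pred[n]≤n (m≤m+n k (s + s)) ,
  DominoesOver-widen k s (DominoesOver-prepend-self d)
... | odd s rewrite +-suc k (s + s) =
  suc k , m≤m+n (suc k) (s + s) , DominoesOver-widen (suc k) s (DominoesOver-prepend-suc d)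

DominoesOver-∷ : ∀ {k} l ls → k ℕ.≤ l → DominoesOver k (b ls) (w ls) →
                 Σ[ k′ ∈ ℕ ] k′ ℕ.≤ l × DominoesOver k′ (b (l ∷ ls)) (w (l ∷ ls))
DominoesOver-∷ l ls k≤l d with DominoesOver-prepend l k≤l d
... | k′ , k′≤l , d′ = k′ , k′≤l , subst₂ (DominoesOver k′) (sym (b-∷ l ls)) (sym (w-∷ l ls)) d′

nonincreasing-∷⇒DominoesOver : ∀ {l ls} → Linked _≥_ (l ∷ ls) →
                                Σ[ k ∈ ℕ ] k ℕ.≤ l × DominoesOver k (b (l ∷ ls)) (w (l ∷ ls))
nonincreasing-∷⇒DominoesOver {l} {[]} [-] = DominoesOver-∷ l [] z≤n (dominoes 0)
nonincreasing-∷⇒DominoesOver {l} {l′ ∷ ls} (l≥l′ ∷ rest) with nonincreasing-∷⇒DominoesOver rest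
... | k , k≤l′ , d = DominoesOver-∷ l (l′ ∷ ls) (≤-trans k≤l′ l≥l′) d

nonincreasing⇒DominoesOver : ∀ {ls} → Linked _≥_ ls → Σ[ k ∈ ℕ ] DominoesOver k (b ls) (w ls)
nonincreasing⇒DominoesOver {[]} _ = 0 , dominoes 0
nonincreasing⇒DominoesOver {_ ∷ _} ls↓ = map₂ proj₂ (nonincreasing-∷⇒DominoesOver ls↓)

SquareGapBound : ℕ → ℕ → Set
SquareGapBound B W = ((+ B) - (+ W)) * ((+ B) - (+ W)) ≤ + B

square-of-gap : ∀ x e → ((+ (x + e)) - (+ x)) * ((+ (x + e)) - (+ x)) ≡ + (e ℕ.* e)
square-of-gap x e = begin
  (+ (x + e) - + x) * (+ (x + e) - + x)      ≡⟨ cong (λ i → (i - + x) * (i - + x)) (pos-+ x e) ⟩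
  (+ x ℤ.+ + e - + x) * (+ x ℤ.+ + e - + x)  ≡⟨ cancel (+ x) (+ e) ⟩
  + e * + e                                  ≡⟨ pos-* e e ⟨
  + (e ℕ.* e)                                ∎
  where
  open ≡-Reasoning
  cancel : ∀ i j → (i ℤ.+ j - i) * (i ℤ.+ j - i) ≡ j * j
  cancel = ℤ-Solver.solve-∀

square-of-gap′ : ∀ x e → ((+ x) - (+ (x + e))) * ((+ x) - (+ (x + e))) ≡ + (e ℕ.* e)
square-of-gap′ x e = begin
  (+ x - + (x + e)) * (+ x - + (x + e))          ≡⟨ cong (λ i → (+ x - i) * (+ x - i)) (pos-+ x e) ⟩
  (+ x - (+ x ℤ.+ + e)) * (+ x - (+ x ℤ.+ + e))  ≡⟨ cancel (+ x) (+ e) ⟩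
  + e * + e                                      ≡⟨ pos-* e e ⟨
  + (e ℕ.* e)                                    ∎
  where
  open ≡-Reasoning
  cancel : ∀ i j → (i - (i ℤ.+ j)) * (i - (i ℤ.+ j)) ≡ j * j
  cancel = ℤ-Solver.solve-∀

SquareGapBound-white : ∀ B e → SquareGapBound B (B + e) ⇔ e ℕ.* e ℕ.≤ B
SquareGapBound-white B e = mk⇔
  (λ bound → drop‿+≤+ (subst (_≤ + B) (square-of-gap′ B e) bound))
  (λ e²≤B → subst (_≤ + B) (sym (square-of-gap′ B e)) (+≤+ e²≤B))

SquareGapBound-black : ∀ W m → SquareGapBound (W + suc m) W ⇔ m ℕ.* m + m ℕ.≤ W
SquareGapBound-black W m = mk⇔
  (λ bound → +-cancelʳ-≤ (suc m) _ W (drop‿+≤+ (subst (_≤ + (W + suc m)) gap² bound)))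
  (λ m²+m≤W → subst (_≤ + (W + suc m)) (sym gap²) (+≤+ (+-monoˡ-≤ (suc m) m²+m≤W)))
  where
  [1+m]*[1+m]≡m*m+m+[1+m] : ∀ m → suc m ℕ.* suc m ≡ m ℕ.* m + m + suc m
  [1+m]*[1+m]≡m*m+m+[1+m] = solve-∀
  gap² : (+ (W + suc m) - + W) * (+ (W + suc m) - + W) ≡ + (m ℕ.* m + m + suc m)
  gap² = trans (square-of-gap W (suc m)) (cong +_ ([1+m]*[1+m]≡m*m+m+[1+m] m))

DominoesOver⇒SquareGapBound : ∀ {k B W} → DominoesOver k B W → SquareGapBound B W
DominoesOver⇒SquareGapBound {k} (dominoes t) with parity k
... | even m rewrite proj₁ (staircase-even m) | proj₂ (staircase-even m) =
  subst (SquareGapBound (t + m ℕ.* m)) (+-assoc t _ m)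
    (Equivalence.from (SquareGapBound-white _ m) (m≤n+m _ t))
... | odd m rewrite proj₁ (staircase-odd m) | proj₂ (staircase-odd m) =
  subst (λ B → SquareGapBound B (t + (m ℕ.* m + m))) (black t m)
    (Equivalence.from (SquareGapBound-black _ m) (m≤n+m _ t))
  where
  black : ∀ t m → t + (m ℕ.* m + m) + suc m ≡ t + suc m ℕ.* suc m
  black = solve-∀

whiteExcess⇒DominoesOver : ∀ B m → SquareGapBound B (B + m) → DominoesOver (m + m) B (B + m)
whiteExcess⇒DominoesOver B m bound
  with m≤n⇒∃[o]m+o≡n (Equivalence.to (SquareGapBound-white B m) bound)
... | t , refl = subst₂ (DominoesOver (m + m)) black white (dominoes t)
  where
  black : t + b (staircase (m + m)) ≡ m ℕ.* m + t
  black = trans (cong (_+_ t) (proj₁ (staircase-even m))) (+-comm t _)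
  white : t + w (staircase (m + m)) ≡ m ℕ.* m + t + m
  white = trans (cong (_+_ t) (proj₂ (staircase-even m))) (rearrange t (m ℕ.* m) m)
    where
    rearrange : ∀ t x m → t + (x + m) ≡ x + t + m
    rearrange = solve-∀

blackExcess⇒DominoesOver : ∀ W m → SquareGapBound (W + suc m) W →
                           DominoesOver (suc (m + m)) (W + suc m) W
blackExcess⇒DominoesOver W m bound
  with m≤n⇒∃[o]m+o≡n (Equivalence.to (SquareGapBound-black W m) bound)
... | t , refl = subst₂ (DominoesOver (suc (m + m))) black white (dominoes t)
  where
  black : t + b (staircase (suc (m + m))) ≡ m ℕ.* m + m + t + suc m
  black = trans (cong (_+_ t) (proj₁ (staircase-odd m))) (rearrange t m)
    where
    rearrange : ∀ t m → t + suc m ℕ.* suc m ≡ m ℕ.* m + m + t + suc m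
    rearrange = solve-∀
  white : t + w (staircase (suc (m + m))) ≡ m ℕ.* m + m + t
  white = trans (cong (_+_ t) (proj₂ (staircase-odd m))) (+-comm t _)

SquareGapBound⇒DominoesOver : ∀ B W → SquareGapBound B W → Σ[ k ∈ ℕ ] DominoesOver k B W
SquareGapBound⇒DominoesOver B W bound with ≤-<-connex B W
... | inj₁ B≤W with m≤n⇒∃[o]m+o≡n B≤W
...   | m , refl = m + m , whiteExcess⇒DominoesOver B m bound
SquareGapBound⇒DominoesOver B W bound | inj₂ W<B with m≤n⇒∃[o]m+o≡n W<B
...   | m , refl = suc (m + m) , subst (λ B → DominoesOver (suc (m + m)) B W) (+-suc W m)
  (blackExcess⇒DominoesOver W m (subst (λ B → SquareGapBound B W) (sym (+-suc W m)) bound))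

dominoStaircase : ℕ → ℕ → List ℕ
dominoStaircase zero zero = []
dominoStaircase zero (suc t) = suc t + suc t ∷ []
dominoStaircase (suc k) t = suc k + (t + t) ∷ staircase k

dominoStaircase-distinct : ∀ k t → IsDistinctPartition (dominoStaircase k t)
dominoStaircase-distinct zero zero = [] , []
dominoStaircase-distinct zero (suc t) = staircase-∷ 0 (s≤s z≤n)
dominoStaircase-distinct (suc k) t = staircase-∷ k (s≤s (m≤m+n k (t + t)))

ColourCount : (List ℕ → Set) → ℕ → ℕ → Set
ColourCount P B W = Σ (List ℕ) (λ ls → P ls × b ls ≡ B × w ls ≡ W)

DominoesOver⇒distinctColourCount : ∀ {k B W} → DominoesOver k B W →
                                   ColourCount IsDistinctPartition B W
DominoesOver⇒distinctColourCount {zero} (dominoes zero) = [] , ([] , []) , refl , refl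
DominoesOver⇒distinctColourCount {zero} (dominoes (suc t)) =
  dominoStaircase zero (suc t) , dominoStaircase-distinct zero (suc t) ,
  b-widen 0 (suc t) [] , w-widen 0 (suc t) []
DominoesOver⇒distinctColourCount {suc k} (dominoes t) =
  dominoStaircase (suc k) t , dominoStaircase-distinct (suc k) t ,
  b-widen (suc k) t (staircase k) , w-widen (suc k) t (staircase k)

distinct⇒partition : ∀ {B W} → ColourCount IsDistinctPartition B W → ColourCount IsPartition B W
distinct⇒partition (ls , (decreasing , positive) , black , white) =
  ls , (Linked.map <⇒≤ decreasing , positive) , black , white

partition⇒SquareGapBound : ∀ {B W} → ColourCount IsPartition B W → SquareGapBound B W
partition⇒SquareGapBound (ls , (nonincreasing , _) , refl , refl) =
  DominoesOver⇒SquareGapBound (proj₂ (nonincreasing⇒DominoesOver nonincreasing))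

SquareGapBound⇒distinct : ∀ B W → SquareGapBound B W → ColourCount IsDistinctPartition B W
SquareGapBound⇒distinct B W bound =
  DominoesOver⇒distinctColourCount (proj₂ (SquareGapBound⇒DominoesOver B W bound))

theoremA : (bb ww : ℕ) →
  ((Σ (List ℕ) (λ ls → IsPartition ls × b ls ≡ bb × w ls ≡ ww))
      ⇔ (((+ bb) - (+ ww)) * ((+ bb) - (+ ww)) ≤ + bb))
  × ((Σ (List ℕ) (λ ls → IsDistinctPartition ls × b ls ≡ bb × w ls ≡ ww))
      ⇔ (((+ bb) - (+ ww)) * ((+ bb) - (+ ww)) ≤ + bb))
theoremA bb ww =
  mk⇔ partition⇒SquareGapBound (distinct⇒partition ∘ SquareGapBound⇒distinct bb ww) ,
  mk⇔ (partition⇒SquareGapBound ∘ distinct⇒partition) (SquareGapBound⇒distinct bb ww)
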